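{- Let $m\ge 1$ be an integer. For every integer $n\ge 0$, \[ \det\bigl(D_m(i+j,x)\bigr)_{0\le i,j\le n}=(xm)^{\binom{n+1}{2}}\prod_{k=1}^{n}k!. \]
   Context: For a positive integer $m$, $W_{m}(n,k)=\frac{1}{m^{k}k!}\sum_{i=0}^{k}\binom{k}{i}(-1)^{k-i}(mi+1)^{n}$ are the Whitney numbers of the second kind of Dowling lattices, and the Dowling polynomials are $D_m(n,x)=\sum_{k=0}^{n}W_m(n,k)x^k$. -}

module Defs where

open import Data.Nat as ℕ using (ℕ; zero; suc; NonZero; _!)
open import Data.Nat.Properties using (m*n≢0; m^n≢0; _!≢0)
open import Data.Nat.Combinatorics using (_C_)
open import Data.Integer as ℤ using (ℤ; +_; _+_; _*_; -_; _/ℕ_; 1ℤ; 0ℤ)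
open import Data.Fin using (Fin; zero; suc; toℕ; punchIn)

ΣFin : (n : ℕ) → (Fin n → ℤ) → ℤ
ΣFin zero    f = 0ℤ
ΣFin (suc n) f = f zero + ΣFin n (λ i → f (suc i))

Σ≤ : (k : ℕ) → (ℕ → ℤ) → ℤ
Σ≤ zero    f = f zero
Σ≤ (suc k) f = Σ≤ k f + f (suc k)

sgn : ℕ → ℤ
sgn zero    = 1ℤ
sgn (suc k) = - sgn k

-- Whitney numbers of the second kind of Dowling lattices:
-- W_m(n,k) = 1/(m^k k!) Σ_{i=0}^k C(k,i) (-1)^(k-i) (m i + 1)^n
-- (the division is exact; computed with integer division)
W : (m : ℕ) .{{_ : NonZero m}} → ℕ → ℕ → ℤ
W m n k =
  let instance _ = m^n≢0 m k
               _ = k !≢0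
               _ = m*n≢0 (m ℕ.^ k) (k !)
  in Σ≤ k (λ i → + (k C i) * sgn (k ℕ.∸ i) * + ((m ℕ.* i ℕ.+ 1) ℕ.^ n))
       /ℕ (m ℕ.^ k ℕ.* k !)

D : (m : ℕ) .{{_ : NonZero m}} → ℕ → ℤ → ℤ
D m n x = Σ≤ n (λ k → W m n k * (x ℤ.^ k))

det : (n : ℕ) → (Fin n → Fin n → ℤ) → ℤ
det zero    A = 1ℤ
det (suc n) A =
  ΣFin (suc n) (λ j → sgn (toℕ j) * A zero j * det n (λ r c → A (suc r) (punchIn j c)))

superfact : ℕ → ℕ
superfact zero    = 1
superfact (suc n) = superfact n ℕ.* (suc n) !

-- Let G k 0 = xᵏ and G k (e+1) = G (k+1) e + (1 + m k) G k e. The Whitney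
-- numbers obey W(n+1,k+1) = W(n,k) + (1 + m(k+1)) W(n,k+1), which gives
-- D_m(n,x) = Σ_k W(n,k) xᵏ = G 0 n. Row elimination with multipliers -(1 + m s) turns the
-- Hankel matrix (G 0 (i+j)) into (G i j), and a second elimination with multiplier -x turns
-- it into (Q i 0 j), where Q (d+1) t = Q d (t+1) - x Q d t. This matrix is upper triangular
-- with diagonal (x m)ⁱ i!, which gives the product.
module Submission where

open import Defs
open import Data.Nat using (ℕ; suc; NonZero)
open import Data.Nat.Combinatorics using (_C_)
open import Data.Integer using (ℤ; +_; _*_; _^_)
open import Data.Fin using (toℕ)
open import Data.Nat using () renaming (_+_ to _+ℕ_)
open import Relation.Binary.PropositionalEquality using (_≡_)

open import Data.Nat as ℕ using (zero; _<_; _≤_; z≤n; s≤s; _!)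
import Data.Nat.Properties as ℕP
open import Data.Nat.Combinatorics using (nC1≡n; nCk+nC[k+1]≡[n+1]C[k+1]; k>n⇒nCk≡0)
open import Data.Nat.DivMod using (m*n/n≡m)
open import Data.Nat.Tactic.RingSolver using () renaming (solve-∀ to solveℕ-∀)
open import Data.Integer as ℤ using (_+_; _-_; -_; _/ℕ_; 0ℤ; 1ℤ)
import Data.Integer.Properties as ℤP
open import Data.Integer.Tactic.RingSolver using (solve-∀)
open import Data.Fin using (Fin; zero; suc; punchIn)
open import Function using (_∘_)
open import Relation.Binary.PropositionalEquality using (refl; sym; trans; cong; cong₂; module ≡-Reasoning)
open ≡-Reasoning

ΣFin-cong : ∀ n {f g : Fin n → ℤ} → (∀ i → f i ≡ g i) → ΣFin n f ≡ ΣFin n g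
ΣFin-cong zero    e = refl
ΣFin-cong (suc n) e = cong₂ _+_ (e zero) (ΣFin-cong n (e ∘ suc))

ΣFin-zero : ∀ n {f : Fin n → ℤ} → (∀ i → f i ≡ 0ℤ) → ΣFin n f ≡ 0ℤ
ΣFin-zero zero    e = refl
ΣFin-zero (suc n) e = cong₂ _+_ (e zero) (ΣFin-zero n (e ∘ suc))

ΣFin-+ : ∀ n (f g : Fin n → ℤ) → ΣFin n (λ i → f i + g i) ≡ ΣFin n f + ΣFin n g
ΣFin-+ zero    f g = refl
ΣFin-+ (suc n) f g = begin
  (f zero + g zero) + ΣFin n (λ i → f (suc i) + g (suc i))
    ≡⟨ cong (_+_ (f zero + g zero)) (ΣFin-+ n (f ∘ suc) (g ∘ suc)) ⟩
  (f zero + g zero) + (ΣFin n (f ∘ suc) + ΣFin n (g ∘ suc))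
    ≡⟨ interchange (f zero) (g zero) _ _ ⟩
  (f zero + ΣFin n (f ∘ suc)) + (g zero + ΣFin n (g ∘ suc)) ∎
  where
  interchange : ∀ a b c d → (a + b) + (c + d) ≡ (a + c) + (b + d)
  interchange = solve-∀

ΣFin-scale : ∀ n (c : ℤ) (f : Fin n → ℤ) → ΣFin n (λ i → c * f i) ≡ c * ΣFin n f
ΣFin-scale zero    c f = sym (ℤP.*-zeroʳ c)
ΣFin-scale (suc n) c f =
  trans (cong (_+_ (c * f zero)) (ΣFin-scale n c (f ∘ suc)))
        (sym (ℤP.*-distribˡ-+ c (f zero) _))

ΣFin-linear : ∀ n (c : ℤ) (f g : Fin n → ℤ) →
  ΣFin n (λ i → f i + c * g i) ≡ ΣFin n f + c * ΣFin n g
ΣFin-linear n c f g =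
  trans (ΣFin-+ n f (λ i → c * g i)) (cong (_+_ (ΣFin n f)) (ΣFin-scale n c g))

Mat : ℕ → Set
Mat n = Fin n → Fin n → ℤ

minor : ∀ {n} → Fin (suc n) → Mat (suc n) → Mat n
minor j A r c = A (suc r) (punchIn j c)

det-expand-cong : ∀ n (A B : Mat (suc n)) → (∀ j → A zero j ≡ B zero j) →
  (∀ j → det n (minor j A) ≡ det n (minor j B)) → det (suc n) A ≡ det (suc n) B
det-expand-cong n A B row₀ minors =
  ΣFin-cong (suc n) (λ j → cong₂ (λ a d → sgn (toℕ j) * a * d) (row₀ j) (minors j))

det-cong : ∀ n (A B : Mat n) → (∀ i j → A i j ≡ B i j) → det n A ≡ det n B
det-cong zero    A B e = refl
det-cong (suc n) A B e =
  det-expand-cong n A B (e zero) (λ j → det-cong n (minor j A) (minor j B) (λ r c → e (suc r) (punchIn j c)))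

-- Expanding det along rows 0 and 1 gives a double sum, with rows u and v and, for each
-- pair of deleted columns, the value R of the remaining rows on the surviving columns.
pairExpansion : ∀ n → (u v : Fin (suc (suc n)) → ℤ) → ((Fin n → Fin (suc (suc n))) → ℤ) → ℤ
pairExpansion n u v R =
  ΣFin (suc (suc n)) λ j → sgn (toℕ j) * u j *
    ΣFin (suc n) λ k → sgn (toℕ k) * v (punchIn j k) * R (λ c → punchIn j (punchIn k c))

-- R depends only on the values of the column embedding (there is no function extensionality).
Extensional : ∀ {n m} → ((Fin n → Fin m) → ℤ) → Set
Extensional R = ∀ {f g} → (∀ c → f c ≡ g c) → R f ≡ R g

pairExpansion-linear : ∀ n (u v w : Fin (suc (suc n)) → ℤ) (c : ℤ) R →
  pairExpansion n u (λ j → v j + c * w j) R ≡ pairExpansion n u v R + c * pairExpansion n u w R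
pairExpansion-linear n u v w c R = begin
  pairExpansion n u (λ j → v j + c * w j) R
    ≡⟨ ΣFin-cong (suc (suc n)) (λ j → cong (sgn (toℕ j) * u j *_)
         (trans (ΣFin-cong (suc n) (λ k → distribʳ (sgn (toℕ k)) (v (punchIn j k)) (w (punchIn j k)) c
                                                  (R (λ c → punchIn j (punchIn k c)))))
                (ΣFin-linear (suc n) c (term v j) (term w j)))) ⟩
  ΣFin (suc (suc n)) (λ j → sgn (toℕ j) * u j * (inner v j + c * inner w j))
    ≡⟨ ΣFin-cong (suc (suc n)) (λ j → distribˡ (sgn (toℕ j) * u j) (inner v j) (inner w j) c) ⟩
  ΣFin (suc (suc n)) (λ j → sgn (toℕ j) * u j * inner v j + c * (sgn (toℕ j) * u j * inner w j))
    ≡⟨ ΣFin-linear (suc (suc n)) c (λ j → sgn (toℕ j) * u j * inner v j)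
                                   (λ j → sgn (toℕ j) * u j * inner w j) ⟩
  pairExpansion n u v R + c * pairExpansion n u w R ∎
  where
  term : (Fin (suc (suc n)) → ℤ) → Fin (suc (suc n)) → Fin (suc n) → ℤ
  term v j k = sgn (toℕ k) * v (punchIn j k) * R (λ c → punchIn j (punchIn k c))
  inner : (Fin (suc (suc n)) → ℤ) → Fin (suc (suc n)) → ℤ
  inner v j = ΣFin (suc n) (term v j)
  distribʳ : ∀ s p q c r → s * (p + c * q) * r ≡ s * p * r + c * (s * q * r)
  distribʳ = solve-∀
  distribˡ : ∀ a p q c → a * (p + c * q) ≡ a * p + c * (a * q)
  distribˡ = solve-∀

lift : ∀ {n m} → (Fin n → Fin m) → Fin (suc n) → Fin (suc m)
lift f zero    = zero
lift f (suc c) = suc (f c)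

-- By induction on n: the
-- terms in which column 0 is deleted first cancel against those in which it is deleted
-- second, and the remaining terms form the pair expansion of the rows with column 0 removed.
pairExpansion-equalRows : ∀ n (u : Fin (suc (suc n)) → ℤ) R → Extensional R →
  pairExpansion n u u R ≡ 0ℤ
pairExpansion-equalRows zero u R ext = cancel (u zero) (u (suc zero)) _ _ (ext (λ ()))
  where
  ring : ∀ a b p → 1ℤ * a * (1ℤ * b * p + 0ℤ) + (- 1ℤ * b * (1ℤ * a * p + 0ℤ) + 0ℤ) ≡ 0ℤ
  ring = solve-∀
  cancel : ∀ a b p q → p ≡ q →
    1ℤ * a * (1ℤ * b * p + 0ℤ) + (- 1ℤ * b * (1ℤ * a * q + 0ℤ) + 0ℤ) ≡ 0ℤ
  cancel a b p .p refl = ring a b p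
pairExpansion-equalRows (suc n) u R ext = begin
  1ℤ * u zero * X + ΣFin (suc (suc n)) (λ j → - sgn (toℕ j) * u (suc j) * inner j)
    ≡⟨ cong (_+_ (1ℤ * u zero * X)) (ΣFin-cong (suc (suc n)) split) ⟩
  1ℤ * u zero * X + ΣFin (suc (suc n)) (λ j → Zt j + (- u zero) * T j)
    ≡⟨ cong (_+_ (1ℤ * u zero * X)) (ΣFin-linear (suc (suc n)) (- u zero) Zt T) ⟩
  1ℤ * u zero * X + (pairExpansion n (u ∘ suc) (u ∘ suc) (R ∘ lift) + (- u zero) * X)
    ≡⟨ cong (λ z → 1ℤ * u zero * X + (z + (- u zero) * X))
            (pairExpansion-equalRows n (u ∘ suc) (R ∘ lift) liftExt) ⟩
  1ℤ * u zero * X + (0ℤ + (- u zero) * X)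
    ≡⟨ cancel (u zero) X ⟩
  0ℤ ∎
  where
  N = suc (suc n)
  -- terms where column 0 is deleted first, resp. second
  X : ℤ
  X = ΣFin N (λ k → sgn (toℕ k) * u (suc k) * R (λ c → suc (punchIn k c)))
  T : Fin N → ℤ
  T j = sgn (toℕ j) * u (suc j) * R (λ c → suc (punchIn j c))
  -- the remaining terms, which never delete column 0
  Z : Fin N → ℤ
  Z j = ΣFin (suc n) (λ k → sgn (toℕ k) * u (suc (punchIn j k)) * R (lift (λ c → punchIn j (punchIn k c))))
  Zt : Fin N → ℤ
  Zt j = sgn (toℕ j) * u (suc j) * Z j
  inner : Fin N → ℤ
  inner j = ΣFin N (λ k → sgn (toℕ k) * u (punchIn (suc j) k) * R (λ c → punchIn (suc j) (punchIn k c)))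
  liftExt : Extensional (R ∘ lift)
  liftExt e = ext (λ { zero → refl ; (suc c) → cong suc (e c) })
  rest : ∀ j →
    ΣFin (suc n) (λ k → - sgn (toℕ k) * u (suc (punchIn j k)) * R (λ c → punchIn (suc j) (punchIn (suc k) c)))
             ≡ - 1ℤ * Z j
  rest j = trans (ΣFin-cong (suc n) (λ k →
                   trans (cong (λ r → - sgn (toℕ k) * u (suc (punchIn j k)) * r) (sameColumns k))
                         (negate (sgn (toℕ k)) (u (suc (punchIn j k))) (R (lift (columns k))))))
                 (ΣFin-scale (suc n) (- 1ℤ) (λ k → sgn (toℕ k) * u (suc (punchIn j k)) * R (lift (columns k))))
    where
    columns : Fin (suc n) → Fin n → Fin (suc (suc n))
    columns k c = punchIn j (punchIn k c)
    sameColumns : ∀ k → R (λ c → punchIn (suc j) (punchIn (suc k) c)) ≡ R (lift (columns k))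
    sameColumns k = ext (λ { zero → refl ; (suc c) → refl })
    negate : ∀ s a r → - s * a * r ≡ - 1ℤ * (s * a * r)
    negate = solve-∀
  split : ∀ j → - sgn (toℕ j) * u (suc j) * inner j ≡ Zt j + (- u zero) * T j
  split j = trans (cong (λ z → - sgn (toℕ j) * u (suc j) * (1ℤ * u zero * R (λ c → suc (punchIn j c)) + z))
                        (rest j))
                  (expand (sgn (toℕ j)) (u (suc j)) (u zero) (R (λ c → suc (punchIn j c))) (Z j))
    where
    expand : ∀ s a u₀ x z → - s * a * (1ℤ * u₀ * x + - 1ℤ * z) ≡ s * a * z + (- u₀) * (s * a * x)
    expand = solve-∀
  cancel : ∀ a x → 1ℤ * a * x + (0ℤ + (- a) * x) ≡ 0ℤ
  cancel = solve-∀

addRow₀₁ : ∀ {n} → ℤ → Mat (suc (suc n)) → Mat (suc (suc n))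
addRow₀₁ c A zero             = A zero
addRow₀₁ c A (suc zero) j     = A (suc zero) j + c * A zero j
addRow₀₁ c A (suc (suc r))    = A (suc (suc r))

-- Adding a multiple of row 0 to row 1 preserves the determinant (linearity + alternation).
det-addRow₀₁ : ∀ n c (A : Mat (suc (suc n))) → det (suc (suc n)) (addRow₀₁ c A) ≡ det (suc (suc n)) A
det-addRow₀₁ n c A = begin
  det (suc (suc n)) (addRow₀₁ c A)
    ≡⟨⟩
  pairExpansion n (A zero) (λ j → A (suc zero) j + c * A zero j) R
    ≡⟨ pairExpansion-linear n (A zero) (A (suc zero)) (A zero) c R ⟩
  det (suc (suc n)) A + c * pairExpansion n (A zero) (A zero) R
    ≡⟨ cong (λ z → det (suc (suc n)) A + c * z) (pairExpansion-equalRows n (A zero) R ext) ⟩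
  det (suc (suc n)) A + c * 0ℤ
    ≡⟨ trans (cong (_+_ (det (suc (suc n)) A)) (ℤP.*-zeroʳ c)) (ℤP.+-identityʳ _) ⟩
  det (suc (suc n)) A ∎
  where
  R : (Fin n → Fin (suc (suc n))) → ℤ
  R f = det n (λ r c → A (suc (suc r)) (f c))
  ext : Extensional R
  ext {f} {g} e = det-cong n _ _ (λ r c → cong (A (suc (suc r))) (e c))

-- By induction on n: undo the change of row 1 with det-addRow₀₁,
-- and the changes of the lower rows inside each minor.
det-bidiagonal : ∀ n (c : ℤ) (R S : ℕ → Fin n → ℤ) → (∀ j → S 0 j ≡ R 0 j) →
  (∀ i j → S (suc i) j ≡ R (suc i) j + c * R i j) →
  det n (λ i → S (toℕ i)) ≡ det n (λ i → R (toℕ i))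
det-bidiagonal zero          c R S top step = refl
det-bidiagonal (suc zero)    c R S top step =
  det-expand-cong 0 (λ i → S (toℕ i)) (λ i → R (toℕ i)) top (λ _ → refl)
det-bidiagonal (suc (suc n)) c R S top step = begin
  det (suc (suc n)) (λ i → S (toℕ i))
    ≡⟨ det-cong (suc (suc n)) (λ i → S (toℕ i)) (addRow₀₁ c B)
                (λ { zero j → top j ; (suc zero) j → step 0 j ; (suc (suc r)) j → refl }) ⟩
  det (suc (suc n)) (addRow₀₁ c B)
    ≡⟨ det-addRow₀₁ n c B ⟩
  det (suc (suc n)) B
    ≡⟨ det-expand-cong (suc n) B (λ i → R (toℕ i)) (λ _ → refl) (λ j →
         det-bidiagonal (suc n) c (λ i col → R (suc i) (punchIn j col)) (λ i col → rowsB (suc i) (punchIn j col))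
           (λ _ → refl) (λ i col → step (suc i) (punchIn j col))) ⟩
  det (suc (suc n)) (λ i → R (toℕ i)) ∎
  where
  rowsB : ℕ → Fin (suc (suc n)) → ℤ
  rowsB zero          = R 0
  rowsB (suc zero)    = R 1
  rowsB (suc (suc i)) = S (suc (suc i))
  B : Mat (suc (suc n))
  B i = rowsB (toℕ i)

-- One bidiagonal step replaces rows 1, 2, … by V 1 0, V 1 1, …,
-- and the claim for the minors (with V shifted by one) finishes the induction.
det-elimination : ∀ n (b : ℕ → ℤ) (V : ℕ → ℕ → Fin n → ℤ) →
  (∀ s t j → V (suc s) t j ≡ V s (suc t) j + b s * V s t j) →
  det n (λ i → V 0 (toℕ i)) ≡ det n (λ i → V (toℕ i) 0)
det-elimination zero    b V rec = refl
det-elimination (suc n) b V rec = begin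
  det (suc n) (λ i → V 0 (toℕ i))
    ≡⟨ sym (det-bidiagonal (suc n) (b 0) (V 0) rows₁ (λ _ → refl) (rec 0)) ⟩
  det (suc n) (λ i → rows₁ (toℕ i))
    ≡⟨ det-expand-cong n (λ i → rows₁ (toℕ i)) (λ i → V (toℕ i) 0) (λ _ → refl) (λ j →
         det-elimination n (b ∘ suc) (λ s t col → V (suc s) t (punchIn j col))
           (λ s t col → rec (suc s) t (punchIn j col))) ⟩
  det (suc n) (λ i → V (toℕ i) 0) ∎
  where
  rows₁ : ℕ → Fin (suc n) → ℤ
  rows₁ zero    = V 0 0
  rows₁ (suc t) = V 1 t

-- If column 0 vanishes below the top entry, only the
-- j = 0 term of the row expansion survives, since every other minor contains the zero
-- column 0; in particular a matrix with a zero first column has determinant zero.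
leadingTerm : ∀ a d → 1ℤ * a * d + 0ℤ ≡ a * d
leadingTerm a d = trans (ℤP.+-identityʳ (1ℤ * a * d)) (cong (_* d) (ℤP.*-identityˡ a))

mutual
  det-firstColumn : ∀ n (A : Mat (suc n)) → (∀ r → A (suc r) zero ≡ 0ℤ) →
    det (suc n) A ≡ A zero zero * det n (minor zero A)
  det-firstColumn zero    A below = leadingTerm (A zero zero) 1ℤ
  det-firstColumn (suc n) A below =
    trans (cong (_+_ (1ℤ * A zero zero * det (suc n) (minor zero A)))
                (ΣFin-zero (suc n) (λ j → trans
                  (cong (sgn (toℕ (suc j)) * A zero (suc j) *_) (det-zeroColumn n (minor (suc j) A) below))
                  (ℤP.*-zeroʳ (sgn (toℕ (suc j)) * A zero (suc j))))))
          (leadingTerm (A zero zero) (det (suc n) (minor zero A)))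

  det-zeroColumn : ∀ n (A : Mat (suc n)) → (∀ r → A r zero ≡ 0ℤ) → det (suc n) A ≡ 0ℤ
  det-zeroColumn n A zeroCol =
    trans (det-firstColumn n A (zeroCol ∘ suc)) (cong (_* det n (minor zero A)) (zeroCol zero))

prod : ℕ → (ℕ → ℤ) → ℤ
prod zero    f = 1ℤ
prod (suc n) f = f 0 * prod n (f ∘ suc)

prod-cong : ∀ n {f g : ℕ → ℤ} → (∀ i → f i ≡ g i) → prod n f ≡ prod n g
prod-cong zero    e = refl
prod-cong (suc n) e = cong₂ _*_ (e 0) (prod-cong n (e ∘ suc))

prod-snoc : ∀ n (f : ℕ → ℤ) → prod (suc n) f ≡ prod n f * f n
prod-snoc zero    f = ℤP.*-comm (f 0) 1ℤ
prod-snoc (suc n) f =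
  trans (cong (f 0 *_) (prod-snoc n (f ∘ suc))) (sym (ℤP.*-assoc (f 0) _ _))

det-upperTriangular : ∀ n (F : ℕ → ℕ → ℤ) → (∀ i j → j < i → F i j ≡ 0ℤ) →
  det n (λ i j → F (toℕ i) (toℕ j)) ≡ prod n (λ i → F i i)
det-upperTriangular zero    F lower = refl
det-upperTriangular (suc n) F lower =
  trans (det-firstColumn n (λ i j → F (toℕ i) (toℕ j)) (λ r → lower (suc (toℕ r)) 0 (s≤s z≤n)))
        (cong (F 0 0 *_) (det-upperTriangular n (λ i j → F (suc i) (suc j)) (λ i j j<i → lower _ _ (s≤s j<i))))

Σ≤-cong : ∀ k {f g : ℕ → ℤ} → (∀ i → i ≤ k → f i ≡ g i) → Σ≤ k f ≡ Σ≤ k g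
Σ≤-cong zero    e = e 0 z≤n
Σ≤-cong (suc k) e = cong₂ _+_ (Σ≤-cong k (λ i i≤k → e i (ℕP.m≤n⇒m≤1+n i≤k))) (e (suc k) ℕP.≤-refl)

Σ≤-peel : ∀ k (f : ℕ → ℤ) → Σ≤ (suc k) f ≡ f 0 + Σ≤ k (f ∘ suc)
Σ≤-peel zero    f = refl
Σ≤-peel (suc k) f = trans (cong (_+ f (suc (suc k))) (Σ≤-peel k f)) (ℤP.+-assoc (f 0) _ _)

Σ≤-+ : ∀ k (f g : ℕ → ℤ) → Σ≤ k (λ i → f i + g i) ≡ Σ≤ k f + Σ≤ k g
Σ≤-+ zero    f g = refl
Σ≤-+ (suc k) f g =
  trans (cong (_+ (f (suc k) + g (suc k))) (Σ≤-+ k f g)) (interchange (Σ≤ k f) (Σ≤ k g) _ _)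
  where
  interchange : ∀ a b c d → (a + b) + (c + d) ≡ (a + c) + (b + d)
  interchange = solve-∀

Σ≤-neg : ∀ k (f : ℕ → ℤ) → Σ≤ k (λ i → - f i) ≡ - Σ≤ k f
Σ≤-neg zero    f = refl
Σ≤-neg (suc k) f =
  trans (cong (_+ - f (suc k)) (Σ≤-neg k f)) (sym (ℤP.neg-distrib-+ (Σ≤ k f) (f (suc k))))

Δ : ℕ → (ℕ → ℤ) → ℤ
Δ k f = Σ≤ k (λ i → + (k C i) * sgn (k ℕ.∸ i) * f i)

Δ-cong : ∀ k {f g : ℕ → ℤ} → (∀ i → f i ≡ g i) → Δ k f ≡ Δ k g
Δ-cong k e = Σ≤-cong k (λ i _ → cong (+ (k C i) * sgn (k ℕ.∸ i) *_) (e i))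

Δ-zero : ∀ f → Δ 0 f ≡ f 0
Δ-zero f = ℤP.*-identityˡ (f 0)

-- Δ^{k+1} f = Δᵏ (f ∘ suc) - Δᵏ f, from Pascal's rule C(k+1,i+1) = C(k,i) + C(k,i+1).
Δ-suc : ∀ k (f : ℕ → ℤ) → Δ (suc k) f ≡ Δ k (f ∘ suc) - Δ k f
Δ-suc k f = begin
  Δ (suc k) f
    ≡⟨ Σ≤-peel k _ ⟩
  first + Σ≤ k (λ i → + (suc k C suc i) * sgn (k ℕ.∸ i) * f (suc i))
    ≡⟨ cong (_+_ first) (trans (Σ≤-cong k (λ i _ → pascal i)) (Σ≤-+ k A B)) ⟩
  first + (Δ k (f ∘ suc) + Σ≤ k B)
    ≡⟨ swap first (Δ k (f ∘ suc)) (Σ≤ k B) ⟩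
  Δ k (f ∘ suc) + (first + Σ≤ k B)
    ≡⟨ cong (_+_ (Δ k (f ∘ suc))) negativePart ⟩
  Δ k (f ∘ suc) - Δ k f ∎
  where
  first = + 1 * sgn (suc k) * f 0
  A B : ℕ → ℤ
  A i = + (k C i) * sgn (k ℕ.∸ i) * f (suc i)
  B i = + (k C suc i) * sgn (k ℕ.∸ i) * f (suc i)
  pascal : ∀ i → + (suc k C suc i) * sgn (k ℕ.∸ i) * f (suc i) ≡ A i + B i
  pascal i = trans (cong (λ c → + c * sgn (k ℕ.∸ i) * f (suc i)) (sym (nCk+nC[k+1]≡[n+1]C[k+1] k i)))
                   (trans (cong (λ c → c * sgn (k ℕ.∸ i) * f (suc i)) (ℤP.pos-+ (k C i) (k C suc i)))
                          (distrib (+ (k C i)) (+ (k C suc i)) (sgn (k ℕ.∸ i)) (f (suc i))))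
    where
    distrib : ∀ a b s c → (a + b) * s * c ≡ a * s * c + b * s * c
    distrib = solve-∀
  swap : ∀ a b c → a + (b + c) ≡ b + (a + c)
  swap = solve-∀
  -- the terms C(k,i) (-1)^(k+1-i) f i for i ≤ k+1; the last one vanishes as C(k,k+1) = 0
  negated : ℕ → ℤ
  negated i = + (k C i) * sgn (suc k ℕ.∸ i) * f i
  negativePart : first + Σ≤ k B ≡ - Δ k f
  negativePart = begin
    first + Σ≤ k B
      ≡⟨ sym (Σ≤-peel k negated) ⟩
    Σ≤ k negated + + (k C suc k) * sgn (k ℕ.∸ k) * f (suc k)
      ≡⟨ cong₂ (λ s c → s + + c * sgn (k ℕ.∸ k) * f (suc k))
               (trans (Σ≤-cong k (λ i i≤k → flip i i≤k)) (Σ≤-neg k _)) (k>n⇒nCk≡0 (ℕP.n<1+n k)) ⟩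
    - Δ k f + 0ℤ
      ≡⟨ ℤP.+-identityʳ _ ⟩
    - Δ k f ∎
    where
    flip : ∀ i → i ≤ k → negated i ≡ - (+ (k C i) * sgn (k ℕ.∸ i) * f i)
    flip i i≤k = trans (cong (λ e → + (k C i) * sgn e * f i) (ℕP.+-∸-assoc 1 i≤k))
                       (negMiddle (+ (k C i)) (sgn (k ℕ.∸ i)) (f i))
      where
      negMiddle : ∀ a s c → a * (- s) * c ≡ - (a * s * c)
      negMiddle = solve-∀

Δ-const : ∀ k (c : ℤ) → Δ (suc k) (λ _ → c) ≡ 0ℤ
Δ-const k c = trans (Δ-suc k (λ _ → c)) (ℤP.+-inverseʳ (Δ k (λ _ → c)))

Δ-one : ∀ f → Δ 1 f ≡ f 1 - f 0
Δ-one f = trans (Δ-suc 0 f) (cong₂ _-_ (Δ-zero (f ∘ suc)) (Δ-zero f))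

Δ-leibniz : ∀ k (α β : ℤ) (f : ℕ → ℤ) →
  Δ (suc k) (λ i → (α + β * + i) * f i) ≡ (α + β * + suc k) * Δ (suc k) f + + suc k * β * Δ k f
Δ-leibniz zero α β f = begin
  Δ 1 (λ i → (α + β * + i) * f i)
    ≡⟨ Δ-one (λ i → (α + β * + i) * f i) ⟩
  (α + β * + 1) * f 1 - (α + β * + 0) * f 0
    ≡⟨ regroup α β (f 0) (f 1) ⟩
  (α + β * + 1) * (f 1 - f 0) + + 1 * β * f 0
    ≡⟨ cong₂ (λ d e → (α + β * + 1) * d + + 1 * β * e) (Δ-one f) (Δ-zero f) ⟨
  (α + β * + 1) * Δ 1 f + + 1 * β * Δ 0 f ∎
  where
  regroup : ∀ α β f₀ f₁ →
    (α + β * + 1) * f₁ - (α + β * + 0) * f₀ ≡ (α + β * + 1) * (f₁ - f₀) + + 1 * β * f₀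
  regroup = solve-∀
Δ-leibniz (suc k) α β f = begin
  Δ (suc (suc k)) g
    ≡⟨ Δ-suc (suc k) g ⟩
  Δ (suc k) (g ∘ suc) - Δ (suc k) g
    ≡⟨ cong (_- Δ (suc k) g) (Δ-cong (suc k) shift) ⟩
  Δ (suc k) (λ i → ((α + β) + β * + i) * f (suc i)) - Δ (suc k) g
    ≡⟨ cong₂ _-_ (Δ-leibniz k (α + β) β (f ∘ suc)) (Δ-leibniz k α β f) ⟩
  ((α + β) + β * K) * S₁ + K * β * S₀ - ((α + β * K) * Δ (suc k) f + K * β * U₀)
    ≡⟨ cong (λ b → ((α + β) + β * K) * S₁ + K * β * S₀ - ((α + β * K) * b + K * β * U₀)) (Δ-suc k f) ⟩
  ((α + β) + β * K) * S₁ + K * β * S₀ - ((α + β * K) * (S₀ - U₀) + K * β * U₀)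
    ≡⟨ regroup α β K S₁ S₀ U₀ ⟩
  (α + β * (1ℤ + K)) * (S₁ - (S₀ - U₀)) + (1ℤ + K) * β * (S₀ - U₀)
    ≡⟨ cong (λ K′ → (α + β * K′) * (S₁ - (S₀ - U₀)) + K′ * β * (S₀ - U₀))
            (ℤP.pos-+ 1 (suc k)) ⟨
  (α + β * K₂) * (S₁ - (S₀ - U₀)) + K₂ * β * (S₀ - U₀)
    ≡⟨ cong (λ b → (α + β * K₂) * (S₁ - b) + K₂ * β * b) (Δ-suc k f) ⟨
  (α + β * K₂) * (S₁ - Δ (suc k) f) + K₂ * β * Δ (suc k) f
    ≡⟨ cong (λ d → (α + β * K₂) * d + K₂ * β * Δ (suc k) f) (Δ-suc (suc k) f) ⟨
  (α + β * K₂) * Δ (suc (suc k)) f + K₂ * β * Δ (suc k) f ∎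
  where
  g : ℕ → ℤ
  g i = (α + β * + i) * f i
  K K₂ S₁ S₀ U₀ : ℤ
  K  = + suc k
  K₂ = + suc (suc k)
  S₁  = Δ (suc k) (f ∘ suc)
  S₀  = Δ k (f ∘ suc)
  U₀  = Δ k f
  shift : ∀ i → g (suc i) ≡ ((α + β) + β * + i) * f (suc i)
  shift i = trans (cong (λ n → (α + β * n) * f (suc i)) (ℤP.pos-+ 1 i)) (unfold α β (+ i) (f (suc i)))
    where
    unfold : ∀ α β n c → (α + β * (1ℤ + n)) * c ≡ ((α + β) + β * n) * c
    unfold = solve-∀
  regroup : ∀ α β K S₁ S₀ U₀ →
    ((α + β) + β * K) * S₁ + K * β * S₀ - ((α + β * K) * (S₀ - U₀) + K * β * U₀)
      ≡ (α + β * (1ℤ + K)) * (S₁ - (S₀ - U₀)) + (1ℤ + K) * β * (S₀ - U₀)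
  regroup = solve-∀

module Whitney (m : ℕ) where

  cf : ℕ → ℤ
  cf k = 1ℤ + + m * + k

  Wh : ℕ → ℕ → ℕ
  Wh n       zero    = 1
  Wh zero    (suc k) = 0
  Wh (suc n) (suc k) = Wh n k ℕ.+ (1 ℕ.+ m ℕ.* suc k) ℕ.* Wh n (suc k)

  Wh-above : ∀ n k → n < k → Wh n k ≡ 0
  Wh-above zero    (suc k) _         = refl
  Wh-above (suc n) (suc k) (s≤s n<k) =
    trans (cong₂ (λ a b → a ℕ.+ (1 ℕ.+ m ℕ.* suc k) ℕ.* b)
                 (Wh-above n k n<k) (Wh-above n (suc k) (ℕP.m<n⇒m<1+n n<k)))
          (ℕP.*-zeroʳ (1 ℕ.+ m ℕ.* suc k))

  Wh-suc : ∀ n k → + Wh (suc n) (suc k) ≡ + Wh n k + cf (suc k) * + Wh n (suc k)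
  Wh-suc n k =
    trans (ℤP.pos-+ (Wh n k) _)
          (cong (_+_ (+ Wh n k))
                (trans (ℤP.pos-* (1 ℕ.+ m ℕ.* suc k) (Wh n (suc k)))
                       (cong (_* + Wh n (suc k))
                             (trans (ℤP.pos-+ 1 (m ℕ.* suc k)) (cong (_+_ 1ℤ) (ℤP.pos-* m (suc k)))))))

  cf-suc : ∀ k → cf (suc k) ≡ cf k + + m
  cf-suc k = trans (cong (λ n → 1ℤ + + m * n) (ℤP.pos-+ 1 k)) (expand (+ m) (+ k))
    where
    expand : ∀ M K → 1ℤ + M * (1ℤ + K) ≡ (1ℤ + M * K) + M
    expand = solve-∀

  whitney-step : ∀ n (h : ℕ → ℤ) →
    Σ≤ (suc n) (λ k → + Wh (suc n) k * h k) ≡ Σ≤ n (λ k → + Wh n k * (h (suc k) + cf k * h k))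
  whitney-step n h = begin
    Σ≤ (suc n) (λ k → + Wh (suc n) k * h k)
      ≡⟨ Σ≤-peel n _ ⟩
    + 1 * h 0 + Σ≤ n (λ k → + Wh (suc n) (suc k) * h (suc k))
      ≡⟨ cong (_+_ (+ 1 * h 0)) (trans (Σ≤-cong n (λ k _ → split k)) (Σ≤-+ n a (c ∘ suc))) ⟩
    + 1 * h 0 + (Σ≤ n a + Σ≤ n (c ∘ suc))
      ≡⟨ regroup (+ m) (h 0) (Σ≤ n a) (Σ≤ n (c ∘ suc)) ⟩
    Σ≤ n a + (c 0 + Σ≤ n (c ∘ suc))
      ≡⟨ cong (_+_ (Σ≤ n a)) (Σ≤-peel n c) ⟨
    Σ≤ n a + (Σ≤ n c + cf (suc n) * + Wh n (suc n) * h (suc n))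
      ≡⟨ cong (λ w → Σ≤ n a + (Σ≤ n c + cf (suc n) * + w * h (suc n))) (Wh-above n (suc n) (ℕP.n<1+n n)) ⟩
    Σ≤ n a + (Σ≤ n c + cf (suc n) * 0ℤ * h (suc n))
      ≡⟨ cong (_+_ (Σ≤ n a)) (dropZero (Σ≤ n c) (cf (suc n)) (h (suc n))) ⟩
    Σ≤ n a + Σ≤ n c
      ≡⟨ Σ≤-+ n a c ⟨
    Σ≤ n (λ k → a k + c k)
      ≡⟨ Σ≤-cong n (λ k _ → factor (+ Wh n k) (h (suc k)) (cf k) (h k)) ⟩
    Σ≤ n (λ k → + Wh n k * (h (suc k) + cf k * h k)) ∎
    where
    a c : ℕ → ℤ
    a k = + Wh n k * h (suc k)
    c k = cf k * + Wh n k * h k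
    split : ∀ k → + Wh (suc n) (suc k) * h (suc k) ≡ a k + c (suc k)
    split k = trans (cong (_* h (suc k)) (Wh-suc n k)) (expand (+ Wh n k) (cf (suc k)) (+ Wh n (suc k)) (h (suc k)))
      where
      expand : ∀ w c v g → (w + c * v) * g ≡ w * g + c * v * g
      expand = solve-∀
    regroup : ∀ M h₀ A S → + 1 * h₀ + (A + S) ≡ A + ((1ℤ + M * + 0) * + 1 * h₀ + S)
    regroup = solve-∀
    dropZero : ∀ s c g → s + c * 0ℤ * g ≡ s
    dropZero = solve-∀
    factor : ∀ w g c g′ → w * g + c * w * g′ ≡ w * (g + c * g′)
    factor = solve-∀

  -- i ↦ (m i + 1)ⁿ, the sequence whose differences define W in Defs.
  powers : ℕ → ℕ → ℤ
  powers n i = + ((m ℕ.* i ℕ.+ 1) ℕ.^ n)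

  powers-suc : ∀ n i → powers (suc n) i ≡ (1ℤ + + m * + i) * powers n i
  powers-suc n i =
    trans (ℤP.pos-* (m ℕ.* i ℕ.+ 1) _)
          (cong (_* powers n i) (trans (ℤP.pos-+ (m ℕ.* i) 1)
                                       (trans (cong (_+ 1ℤ) (ℤP.pos-* m i)) (ℤP.+-comm (+ m * + i) 1ℤ))))

  scale : ℕ → ℤ
  scale k = + (m ℕ.^ k ℕ.* k !)

  scale-suc : ∀ k → scale (suc k) ≡ + suc k * + m * scale k
  scale-suc k =
    trans (cong +_ (reorder m (m ℕ.^ k) (suc k) (k !)))
          (trans (ℤP.pos-* (suc k ℕ.* m) _) (cong (_* scale k) (ℤP.pos-* (suc k) m)))
    where
    reorder : ∀ m p s f → m ℕ.* p ℕ.* (s ℕ.* f) ≡ s ℕ.* m ℕ.* (p ℕ.* f)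
    reorder = solveℕ-∀

  -- The explicit formula: Δᵏ (i ↦ (m i + 1)ⁿ) = mᵏ k! Wh(n,k), by induction on n via the
  -- Leibniz rule, since (m i + 1)^{n+1} = (1 + m i)(m i + 1)ⁿ.
  Δ-powers : ∀ n k → Δ k (powers n) ≡ scale k * + Wh n k
  Δ-powers n zero =
    trans (Δ-zero (powers n))
          (trans (cong (λ a → + ((a ℕ.+ 1) ℕ.^ n)) (ℕP.*-zeroʳ m)) (cong +_ (ℕP.^-zeroˡ n)))
  Δ-powers zero (suc k) = trans (Δ-const k 1ℤ) (sym (ℤP.*-zeroʳ (scale (suc k))))
  Δ-powers (suc n) (suc k) = begin
    Δ (suc k) (powers (suc n))
      ≡⟨ Δ-cong (suc k) (powers-suc n) ⟩
    Δ (suc k) (λ i → (1ℤ + + m * + i) * powers n i)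
      ≡⟨ Δ-leibniz k 1ℤ (+ m) (powers n) ⟩
    cf (suc k) * Δ (suc k) (powers n) + + suc k * + m * Δ k (powers n)
      ≡⟨ cong₂ (λ a b → cf (suc k) * a + + suc k * + m * b) (Δ-powers n (suc k)) (Δ-powers n k) ⟩
    cf (suc k) * (scale (suc k) * + Wh n (suc k)) + + suc k * + m * (scale k * + Wh n k)
      ≡⟨ cong (λ s → cf (suc k) * (s * + Wh n (suc k)) + + suc k * + m * (scale k * + Wh n k)) (scale-suc k) ⟩
    cf (suc k) * (+ suc k * + m * scale k * + Wh n (suc k)) + + suc k * + m * (scale k * + Wh n k)
      ≡⟨ factor (cf (suc k)) (+ suc k * + m) (scale k) (+ Wh n (suc k)) (+ Wh n k) ⟩
    + suc k * + m * scale k * (+ Wh n k + cf (suc k) * + Wh n (suc k))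
      ≡⟨ cong₂ _*_ (scale-suc k) (Wh-suc n k) ⟨
    scale (suc k) * + Wh (suc n) (suc k) ∎
    where
    factor : ∀ c q s w₁ w₀ → c * (q * s * w₁) + q * (s * w₀) ≡ q * s * (w₀ + c * w₁)
    factor = solve-∀

  W≡Wh : .{{_ : NonZero m}} → ∀ n k → W m n k ≡ + Wh n k
  W≡Wh n k = begin
    Δ k (powers n) /ℕ d
      ≡⟨ cong (_/ℕ d) (trans (Δ-powers n k) (sym (ℤP.pos-* d (Wh n k)))) ⟩
    + (d ℕ.* Wh n k) /ℕ d
      ≡⟨ cong +_ (trans (cong (ℕ._/ d) (ℕP.*-comm d (Wh n k))) (m*n/n≡m (Wh n k) d)) ⟩
    + Wh n k ∎
    where
    d = m ℕ.^ k ℕ.* k !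
    instance
      d≢0 : NonZero d
      d≢0 = ℕP.m*n≢0 (m ℕ.^ k) (k !) {{ℕP.m^n≢0 m k}} {{k ℕP.!≢0}}

module Dowling (m : ℕ) (x : ℤ) where
  open Whitney m

  -- G k 0 = xᵏ and G k (e+1) = G (k+1) e + (1 + m k) G k e. The row G 0 is the sequence of
  -- Dowling polynomials, and G k is what elimination makes of the Hankel row k.
  G : ℕ → ℕ → ℤ
  G k zero    = x ^ k
  G k (suc e) = G (suc k) e + cf k * G k e

  -- The recurrence of G in the shape required by det-elimination (multiplier -(1 + m s)).
  G-elim : ∀ s e → G (suc s) e ≡ G s (suc e) + (- cf s) * G s e
  G-elim s e = cancel (G (suc s) e) (cf s) (G s e)
    where
    cancel : ∀ a c g → a ≡ (a + c * g) + (- c) * g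
    cancel = solve-∀

  whitney-G : ∀ n e → Σ≤ n (λ k → + Wh n k * G k e) ≡ G 0 (n ℕ.+ e)
  whitney-G zero    e = ℤP.*-identityˡ (G 0 e)
  whitney-G (suc n) e =
    trans (whitney-step n (λ k → G k e)) (trans (whitney-G n (suc e)) (cong (G 0) (ℕP.+-suc n e)))

  D≡G : .{{_ : NonZero m}} → ∀ n → D m n x ≡ G 0 n
  D≡G n = begin
    Σ≤ n (λ k → W m n k * x ^ k)
      ≡⟨ Σ≤-cong n (λ k _ → cong (_* x ^ k) (W≡Wh n k)) ⟩
    Σ≤ n (λ k → + Wh n k * G k 0)
      ≡⟨ whitney-G n 0 ⟩
    G 0 (n ℕ.+ 0)
      ≡⟨ cong (G 0) (ℕP.+-identityʳ n) ⟩
    G 0 n ∎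

  -- Iterated differences Q (d+1) t = Q d (t+1) - x Q d t of G in its first index; the
  -- second elimination (multiplier -x) produces the rows Q d 0.
  Q : ℕ → ℕ → ℕ → ℤ
  Q zero    t j = G t j
  Q (suc d) t j = Q d (suc t) j + (- x) * Q d t j

  Q-rec : ∀ d k j → Q (suc d) k (suc j) ≡ Q (suc d) (suc k) j + cf k * Q (suc d) k j + + m * + suc d * Q d (suc k) j
  Q-rec zero k j =
    trans (cong (λ c → G (suc (suc k)) j + c * G (suc k) j + (- x) * (G (suc k) j + cf k * G k j)) (cf-suc k))
          (regroup x (G (suc (suc k)) j) (G (suc k) j) (G k j) (cf k) (+ m))
    where
    regroup : ∀ x g₂ g₁ g₀ c M → g₂ + (c + M) * g₁ + (- x) * (g₁ + c * g₀)
                              ≡ (g₂ + (- x) * g₁) + c * (g₁ + (- x) * g₀) + M * + 1 * g₁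
    regroup = solve-∀
  Q-rec (suc d) k j = begin
    Q (suc d) (suc k) (suc j) + (- x) * Q (suc d) k (suc j)
      ≡⟨ cong₂ (λ u v → u + (- x) * v) (Q-rec d (suc k) j) (Q-rec d k j) ⟩
    (Q (suc d) (suc (suc k)) j + cf (suc k) * Q (suc d) (suc k) j + M * Q d (suc (suc k)) j)
      + (- x) * (Q (suc d) (suc k) j + cf k * Q (suc d) k j + M * Q d (suc k) j)
      ≡⟨ cong (λ c → Q (suc d) (suc (suc k)) j + c * Q (suc d) (suc k) j + M * Q d (suc (suc k)) j
                       + (- x) * (Q (suc d) (suc k) j + cf k * Q (suc d) k j + M * Q d (suc k) j)) (cf-suc k) ⟩
    (Q (suc d) (suc (suc k)) j + (cf k + + m) * Q (suc d) (suc k) j + M * Q d (suc (suc k)) j)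
      + (- x) * (Q (suc d) (suc k) j + cf k * Q (suc d) k j + M * Q d (suc k) j)
      ≡⟨ regroup x (Q (suc d) (suc (suc k)) j) (Q (suc d) k j) (Q d (suc (suc k)) j) (Q d (suc k) j) (cf k) (+ m) M ⟩
    Q (suc (suc d)) (suc k) j + cf k * Q (suc (suc d)) k j + (M + + m) * Q (suc d) (suc k) j
      ≡⟨ cong (λ c → Q (suc (suc d)) (suc k) j + cf k * Q (suc (suc d)) k j + c * Q (suc d) (suc k) j)
              (trans (cong (+ m *_) (ℤP.pos-+ 1 (suc d))) (distrib (+ m) (+ suc d))) ⟨
    Q (suc (suc d)) (suc k) j + cf k * Q (suc (suc d)) k j + + m * + suc (suc d) * Q (suc d) (suc k) j ∎
    where
    M = + m * + suc d
    -- here q₁ = Q (d+1) (k+1) j is itself p₂ - x p₁, with p = Q d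
    regroup : ∀ x q₂ q₀ p₂ p₁ c m M →
      (q₂ + (c + m) * (p₂ + (- x) * p₁) + M * p₂) + (- x) * ((p₂ + (- x) * p₁) + c * q₀ + M * p₁)
        ≡ (q₂ + (- x) * (p₂ + (- x) * p₁)) + c * ((p₂ + (- x) * p₁) + (- x) * q₀)
          + (M + m) * (p₂ + (- x) * p₁)
    regroup = solve-∀
    distrib : ∀ M D → M * (1ℤ + D) ≡ M * D + M
    distrib = solve-∀

  Q-firstColumn : ∀ d k → Q (suc d) k 0 ≡ 0ℤ
  Q-firstColumn zero    k = cancel x (x ^ k)
    where
    cancel : ∀ x p → x * p + (- x) * p ≡ 0ℤ
    cancel = solve-∀
  Q-firstColumn (suc d) k =
    trans (cong₂ (λ a b → a + (- x) * b) (Q-firstColumn d (suc k)) (Q-firstColumn d k))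
          (trans (ℤP.+-identityˡ ((- x) * 0ℤ)) (ℤP.*-zeroʳ (- x)))

  Q-vanish : ∀ d k j → j < d → Q d k j ≡ 0ℤ
  Q-vanish zero    k j       ()
  Q-vanish (suc d) k zero    _         = Q-firstColumn d k
  Q-vanish (suc d) k (suc j) (s≤s j<d) = begin
    Q (suc d) k (suc j)
      ≡⟨ Q-rec d k j ⟩
    Q (suc d) (suc k) j + cf k * Q (suc d) k j + + m * + suc d * Q d (suc k) j
      ≡⟨ cong₂ (λ a b → a + cf k * b + + m * + suc d * Q d (suc k) j)
               (Q-vanish (suc d) (suc k) j (ℕP.m<n⇒m<1+n j<d)) (Q-vanish (suc d) k j (ℕP.m<n⇒m<1+n j<d)) ⟩
    0ℤ + cf k * 0ℤ + + m * + suc d * Q d (suc k) j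
      ≡⟨ cong (λ q → 0ℤ + cf k * 0ℤ + + m * + suc d * q) (Q-vanish d (suc k) j j<d) ⟩
    0ℤ + cf k * 0ℤ + + m * + suc d * 0ℤ
      ≡⟨ zeros (cf k) (+ m * + suc d) ⟩
    0ℤ ∎
    where
    zeros : ∀ c M → 0ℤ + c * 0ℤ + M * 0ℤ ≡ 0ℤ
    zeros = solve-∀

  Q-diagonal : ∀ d k → Q d k d ≡ x ^ k * ((x * + m) ^ d * + (d !))
  Q-diagonal zero    k = sym (ℤP.*-identityʳ (x ^ k))
  Q-diagonal (suc d) k = begin
    Q (suc d) k (suc d)
      ≡⟨ Q-rec d k d ⟩
    Q (suc d) (suc k) d + cf k * Q (suc d) k d + + m * + suc d * Q d (suc k) d
      ≡⟨ cong₂ (λ a b → a + cf k * b + + m * + suc d * Q d (suc k) d)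
               (Q-vanish (suc d) (suc k) d (ℕP.n<1+n d)) (Q-vanish (suc d) k d (ℕP.n<1+n d)) ⟩
    0ℤ + cf k * 0ℤ + + m * + suc d * Q d (suc k) d
      ≡⟨ cong (λ q → 0ℤ + cf k * 0ℤ + + m * + suc d * q) (Q-diagonal d (suc k)) ⟩
    0ℤ + cf k * 0ℤ + + m * + suc d * (x * x ^ k * ((x * + m) ^ d * + (d !)))
      ≡⟨ regroup (cf k) (+ m) (+ suc d) x (x ^ k) ((x * + m) ^ d) (+ (d !)) ⟩
    x ^ k * ((x * + m) * (x * + m) ^ d * (+ suc d * + (d !)))
      ≡⟨ cong (λ f → x ^ k * ((x * + m) ^ suc d * f)) (ℤP.pos-* (suc d) (d !)) ⟨
    x ^ k * ((x * + m) ^ suc d * + (suc d !)) ∎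
    where
    regroup : ∀ c m s x p y f → 0ℤ + c * 0ℤ + m * s * (x * p * (y * f)) ≡ p * ((x * m) * y * (s * f))
    regroup = solve-∀

-- ∏_{i ≤ n} yⁱ i! = y^C(n+1,2) ∏_{k ≤ n} k!, as C(n+2,2) = (n+1) + C(n+1,2).
prod-superfactorial : ∀ (y : ℤ) n → prod (suc n) (λ i → y ^ i * + (i !)) ≡ y ^ (suc n C 2) * + superfact n
prod-superfactorial y zero    = refl
prod-superfactorial y (suc n) = begin
  prod (suc (suc n)) f
    ≡⟨ prod-snoc (suc n) f ⟩
  prod (suc n) f * f (suc n)
    ≡⟨ cong (_* f (suc n)) (prod-superfactorial y n) ⟩
  y ^ (suc n C 2) * + superfact n * (y ^ suc n * + (suc n !))
    ≡⟨ regroup (y ^ (suc n C 2)) (+ superfact n) (y ^ suc n) (+ (suc n !)) ⟩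
  (y ^ suc n * y ^ (suc n C 2)) * (+ superfact n * + (suc n !))
    ≡⟨ cong₂ _*_ (ℤP.^-distribˡ-+-* y (suc n) (suc n C 2)) (ℤP.pos-* (superfact n) (suc n !)) ⟨
  y ^ (suc n ℕ.+ suc n C 2) * + superfact (suc n)
    ≡⟨ cong (λ e → y ^ e * + superfact (suc n)) binomial ⟩
  y ^ (suc (suc n) C 2) * + superfact (suc n) ∎
  where
  f : ℕ → ℤ
  f i = y ^ i * + (i !)
  regroup : ∀ a b c d → a * b * (c * d) ≡ (c * a) * (b * d)
  regroup = solve-∀
  binomial : suc n ℕ.+ suc n C 2 ≡ suc (suc n) C 2
  binomial = trans (cong (ℕ._+ (suc n C 2)) (sym (nC1≡n (suc n)))) (nCk+nC[k+1]≡[n+1]C[k+1] (suc n) 1)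

mainTheorem8 : (m : ℕ) .{{_ : NonZero m}} (n : ℕ) (x : ℤ) →
    det (suc n) (λ i j → D m (toℕ i +ℕ toℕ j) x)
      ≡ (x * + m) ^ (suc n C 2) * + superfact n
mainTheorem8 m n x = begin
  det (suc n) (λ i j → D m (toℕ i +ℕ toℕ j) x)
    ≡⟨ det-cong (suc n) _ _ (λ i j → D≡G (toℕ i +ℕ toℕ j)) ⟩
  det (suc n) (λ i j → G 0 (toℕ i +ℕ toℕ j))
    ≡⟨ det-elimination (suc n) (λ s → - cf s) (λ s t j → G s (t +ℕ toℕ j))
                       (λ s t j → G-elim s (t +ℕ toℕ j)) ⟩
  det (suc n) (λ i j → G (toℕ i) (toℕ j))
    ≡⟨ det-elimination (suc n) (λ _ → - x) (λ d t j → Q d t (toℕ j)) (λ _ _ _ → refl) ⟩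
  det (suc n) (λ i j → Q (toℕ i) 0 (toℕ j))
    ≡⟨ det-upperTriangular (suc n) (λ i j → Q i 0 j) (λ i j j<i → Q-vanish i 0 j j<i) ⟩
  prod (suc n) (λ i → Q i 0 i)
    ≡⟨ prod-cong (suc n) (λ i → trans (Q-diagonal i 0) (ℤP.*-identityˡ _)) ⟩
  prod (suc n) (λ i → (x * + m) ^ i * + (i !))
    ≡⟨ prod-superfactorial (x * + m) n ⟩
  (x * + m) ^ (suc n C 2) * + superfact n ∎
  where
  open Whitney m
  open Dowling m x
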